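{- Let $q$ be a power of an odd prime, let $\lambda\in\mathbb{F}_q$ be a non-square, and let $a\in\mathbb{F}_q^*$. The graph $\mathcal{G}(\lambda,X+a)$ has a (weakly) connected component with exactly two vertices if and only if $\lambda\neq -1$ and $a=2(\lambda+1)/(\lambda-1)^2$. In particular, if $\lambda\neq-1$ and $a=2(\lambda+1)/(\lambda-1)^2$, then the vertices $2/(1-\lambda)$ and $2/(\lambda-1)$ form a connected component of $\mathcal{G}(\lambda,X+a)$.
   Context: For a polynomial $f\in\mathbb{F}_q[X]$ and a non-square $\lambda\in\mathbb{F}_q$, $\mathcal{G}(\lambda,f)$ is the directed graph with vertex set $\mathbb{F}_q$ and an edge from $x$ to $y$ iff $(y^2-f(x))(\lambda y^2-f(x))=0$ (loops allowed). -}

module Defs where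

open import Level using (_⊔_; suc)
open import Data.Nat using (ℕ)
open import Data.Fin using (Fin)
open import Data.Product using (Σ; ∃; _×_)
open import Data.Sum using (_⊎_)
open import Relation.Nullary using (¬_)
open import Algebra.Bundles using (CommutativeRing)
open import Function.Bundles using (Inverse)
open import Relation.Binary.PropositionalEquality as ≡ using ()
open import Relation.Binary.Construct.Closure.Equivalence using (EqClosure)

-- A finite field with exactly q elements: a commutative ring with 0 ≠ 1,
-- a (total) inverse operation that is a genuine inverse on nonzero elements
-- (with the harmless convention that 0⁻¹ = 0, so that division is total),
-- and a bijection (up to the ring's setoid equality) with Fin q.
record FiniteField (c ℓ : Level.Level) (q : ℕ) : Set (Level.suc (c ⊔ ℓ)) where
  field
    commRing : CommutativeRing c ℓ
  open CommutativeRing commRing public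
  field
    _⁻¹      : Carrier → Carrier
    ⁻¹-cong  : ∀ {x y} → x ≈ y → x ⁻¹ ≈ y ⁻¹
    0≉1      : ¬ (0# ≈ 1#)
    inverseʳ : ∀ x → ¬ (x ≈ 0#) → x * (x ⁻¹) ≈ 1#
    0⁻¹≈0    : 0# ⁻¹ ≈ 0#
    finite   : Inverse setoid (≡.setoid (Fin q))

  infixl 7 _/_
  _/_ : Carrier → Carrier → Carrier
  x / y = x * (y ⁻¹)

  2# : Carrier
  2# = 1# + 1#

  NonSquare : Carrier → Set (c ⊔ ℓ)
  NonSquare l = ¬ (∃ λ z → z * z ≈ l)

  Edge : (Carrier → Carrier) → Carrier → Carrier → Carrier → Set ℓ
  Edge f l x y = ((y * y) - f x) * ((l * (y * y)) - f x) ≈ 0#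

  WConnected : (Carrier → Carrier) → Carrier → Carrier → Carrier → Set (c ⊔ ℓ)
  WConnected f l = EqClosure (Edge f l)

  IsTwoComponent : (Carrier → Carrier) → Carrier → Carrier → Carrier → Set (c ⊔ ℓ)
  IsTwoComponent f l x y =
    ¬ (x ≈ y) × WConnected f l x y × (∀ z → WConnected f l x z → z ≈ x ⊎ z ≈ y)

  HasTwoComponent : (Carrier → Carrier) → Carrier → Set (c ⊔ ℓ)
  HasTwoComponent f l = ∃ λ x → ∃ λ y → IsTwoComponent f l x y

-- An edge x ⟶ y of 𝒢(λ, X + a) means x = μy² − a with μ ∈ {1, λ}, so the in-neighbours of y
-- are pred 1# y and pred λ y, which differ unless y = 0.  Call w ≠ 0 a root when pred 1# w = −w
-- and pred λ w = w.  For a root the pair {w, −w} is closed under edges in both directions (λ being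
-- a non-square rules out the mixed cases), so it is a two-vertex component; subtracting the two
-- equations gives (λ − 1)w = 2, whence a = w² + w = 2(λ + 1)/(λ − 1)², and λ = −1 would force
-- a = 0.  Conversely, in a two-vertex component {x, y} both vertices are nonzero, so the
-- in-neighbours of each are exactly x and y.  Of the four possible assignments two produce a
-- root; in the other two one of the maps s ↦ μs² − a fixes x and y while the other swaps them,
-- which makes λ a square.

module Submission where

open import Defs
open import Level using (Level)
open import Data.Nat using (ℕ; _^_)
open import Data.Nat.Primality using (Prime)
open import Data.Product using (_×_)
open import Relation.Nullary using (¬_)
open import Relation.Binary.PropositionalEquality using (_≡_; _≢_)
open import Function.Bundles using (_⇔_)

open import Level using (_⊔_)
open import Algebra.Bundles using (CommutativeRing)
import Algebra.Solver.Ring.AlmostCommutativeRing as ACR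
import Data.Nat as ℕ
import Data.Nat.Properties as ℕ
open import Data.Integer as ℤ using (ℤ; +_; -[1+_]; _⊖_; ∣_∣; sign)
import Data.Integer.Properties as ℤ
open import Data.Sign as Sign using (Sign)
open import Data.Fin as Fin using (Fin)
open import Data.Fin.Properties using (any?; injective⇒≤; punchOut-injective)
open import Data.Maybe using (Maybe; just; nothing)
open import Data.Product using (∃; _,_; -,_; proj₁; proj₂)
open import Data.Sum using (_⊎_; inj₁; inj₂; swap)
open import Data.Empty using (⊥; ⊥-elim)
open import Function.Base using (_∘_)
open import Function.Bundles using (Inverse; mk⇔)
open import Function.Definitions using (Injective; StrictlySurjective)
open import Relation.Nullary using (yes; no; contradiction)
open import Relation.Unary using (Pred)
open import Relation.Binary.Core using (Rel)
open import Relation.Binary.Definitions using (Decidable)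
import Relation.Binary.PropositionalEquality as ≡
open import Relation.Binary.Construct.Closure.Equivalence using (EqClosure)
open import Relation.Binary.Construct.Closure.ReflexiveTransitive using (ε; _◅_; _◅◅_; return)
open import Relation.Binary.Construct.Closure.Symmetric using (fwd; bwd)

injective⇒strictlySurjective : ∀ {n} {f : Fin n → Fin n} → Injective _≡_ _≡_ f → StrictlySurjective _≡_ f
injective⇒strictlySurjective {ℕ.zero}          _           ()
injective⇒strictlySurjective {ℕ.suc _} {f = f} f-injective y with any? (λ x → f x Fin.≟ y)
... | yes hit = hit
... | no miss = contradiction (injective⇒≤ (f-injective ∘ punchOut-injective (miss ∘ (_ ,_) ∘ ≡.sym) (miss ∘ (_ ,_) ∘ ≡.sym)))
                              ℕ.1+n≰n

EqClosure-preserves : ∀ {a r p} {A : Set a} {R : Rel A r} (P : Pred A p) →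
  (∀ {x y} → R x y → P x → P y) → (∀ {x y} → R x y → P y → P x) →
  ∀ {x y} → EqClosure R x y → P x → P y
EqClosure-preserves P forward backward ε           Px = Px
EqClosure-preserves P forward backward (fwd r ◅ s) Px = EqClosure-preserves P forward backward s (forward r Px)
EqClosure-preserves P forward backward (bwd r ◅ s) Px = EqClosure-preserves P forward backward s (backward r Px)

-- Tactic.RingSolver takes its coefficients from the ring itself and so cannot cancel 1# - 1#;
-- Algebra.Solver.Ring with integer coefficients works in every commutative ring.
module IntegerRingSolver {c ℓ : Level} (R : CommutativeRing c ℓ) where
  open CommutativeRing R
  open import Relation.Binary.Reasoning.Setoid setoid
  open import Algebra.Properties.Ring ring using (-1*x≈-x; -‿+-comm; -0#≈0#; -‿involutive)
  open import Algebra.Properties.Semiring.Mult.TCOptimised semiring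
    using (1+×; ×-homo-+; ×1-homo-*) renaming (_×_ to _·_)
  open import Algebra.Properties.CommutativeSemigroup *-commutativeSemigroup using () renaming (interchange to *-interchange)
  open import Algebra.Properties.CommutativeSemigroup +-commutativeSemigroup using () renaming (interchange to +-interchange)

  fromℕ : ℕ.ℕ → Carrier
  fromℕ n = n · 1#

  fromℤ : ℤ → Carrier
  fromℤ (+ n)    = fromℕ n
  fromℤ -[1+ n ] = - fromℕ (ℕ.suc n)

  fromSign : Sign → Carrier
  fromSign Sign.+ = 1#
  fromSign Sign.- = - 1#

  fromSign-homo-* : ∀ s t → fromSign (s Sign.* t) ≈ fromSign s * fromSign t
  fromSign-homo-* Sign.+ _      = sym (*-identityˡ _)
  fromSign-homo-* Sign.- Sign.+ = sym (*-identityʳ _)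
  fromSign-homo-* Sign.- Sign.- = sym (trans (-1*x≈-x _) (-‿involutive _))

  fromℤ-◃ : ∀ s n → fromℤ (s ℤ.◃ n) ≈ fromSign s * fromℕ n
  fromℤ-◃ s      ℕ.zero    = sym (zeroʳ _)
  fromℤ-◃ Sign.+ (ℕ.suc n) = sym (*-identityˡ _)
  fromℤ-◃ Sign.- (ℕ.suc n) = sym (-1*x≈-x _)

  fromℤ-signAbs : ∀ i → fromℤ i ≈ fromSign (sign i) * fromℕ ∣ i ∣
  fromℤ-signAbs (+ n)    = sym (*-identityˡ _)
  fromℤ-signAbs -[1+ n ] = sym (-1*x≈-x _)

  fromℤ-homo-* : ∀ i j → fromℤ (i ℤ.* j) ≈ fromℤ i * fromℤ j
  fromℤ-homo-* i j = begin
    fromℤ (i ℤ.* j)                                                     ≈⟨ fromℤ-◃ (sign i Sign.* sign j) (∣ i ∣ ℕ.* ∣ j ∣) ⟩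
    fromSign (sign i Sign.* sign j) * fromℕ (∣ i ∣ ℕ.* ∣ j ∣)             ≈⟨ *-cong (fromSign-homo-* (sign i) (sign j)) (×1-homo-* ∣ i ∣ ∣ j ∣) ⟩
    (fromSign (sign i) * fromSign (sign j)) * (fromℕ ∣ i ∣ * fromℕ ∣ j ∣) ≈⟨ *-interchange _ _ _ _ ⟩
    (fromSign (sign i) * fromℕ ∣ i ∣) * (fromSign (sign j) * fromℕ ∣ j ∣) ≈⟨ *-cong (fromℤ-signAbs i) (fromℤ-signAbs j) ⟨
    fromℤ i * fromℤ j                                                   ∎

  fromℤ-⊖ : ∀ m n → fromℤ (m ⊖ n) ≈ fromℕ m - fromℕ n
  fromℤ-⊖ m         ℕ.zero    = sym (trans (+-congˡ -0#≈0#) (+-identityʳ _))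
  fromℤ-⊖ ℕ.zero    (ℕ.suc n) = sym (+-identityˡ _)
  fromℤ-⊖ (ℕ.suc m) (ℕ.suc n) = begin
    fromℤ (ℕ.suc m ⊖ ℕ.suc n)            ≡⟨ ≡.cong fromℤ (ℤ.[1+m]⊖[1+n]≡m⊖n m n) ⟩
    fromℤ (m ⊖ n)                        ≈⟨ fromℤ-⊖ m n ⟩
    fromℕ m - fromℕ n                    ≈⟨ +-identityˡ _ ⟨
    0# + (fromℕ m - fromℕ n)             ≈⟨ +-congʳ (-‿inverseʳ 1#) ⟨
    (1# - 1#) + (fromℕ m - fromℕ n)      ≈⟨ +-interchange _ _ _ _ ⟨
    (1# + fromℕ m) + (- 1# - fromℕ n)    ≈⟨ +-cong (1+× m 1#) (trans (-‿cong (1+× n 1#)) (sym (-‿+-comm 1# (fromℕ n)))) ⟨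
    fromℕ (ℕ.suc m) - fromℕ (ℕ.suc n)   ∎

  fromℤ-homo-+ : ∀ i j → fromℤ (i ℤ.+ j) ≈ fromℤ i + fromℤ j
  fromℤ-homo-+ -[1+ m ] -[1+ n ] = begin
    - fromℕ (ℕ.suc (ℕ.suc (m ℕ.+ n)))       ≡⟨ ≡.cong (λ k → - fromℕ (ℕ.suc k)) (ℕ.+-suc m n) ⟨
    - fromℕ (ℕ.suc m ℕ.+ ℕ.suc n)           ≈⟨ -‿cong (×-homo-+ 1# (ℕ.suc m) (ℕ.suc n)) ⟩
    - (fromℕ (ℕ.suc m) + fromℕ (ℕ.suc n))   ≈⟨ -‿+-comm _ _ ⟨
    - fromℕ (ℕ.suc m) + - fromℕ (ℕ.suc n)   ∎
  fromℤ-homo-+ -[1+ m ] (+ n)    = trans (fromℤ-⊖ n (ℕ.suc m)) (+-comm _ _)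
  fromℤ-homo-+ (+ m)    -[1+ n ] = fromℤ-⊖ m (ℕ.suc n)
  fromℤ-homo-+ (+ m)    (+ n)    = ×-homo-+ 1# m n

  fromℤ-homo-neg : ∀ i → fromℤ (ℤ.- i) ≈ - fromℤ i
  fromℤ-homo-neg (+ ℕ.zero)  = sym -0#≈0#
  fromℤ-homo-neg (+ ℕ.suc n) = refl
  fromℤ-homo-neg -[1+ n ]    = sym (-‿involutive _)

  fromℤ-morphism : ℤ.+-*-rawRing ACR.-Raw-AlmostCommutative⟶ ACR.fromCommutativeRing R
  fromℤ-morphism = record
    { ⟦_⟧ = fromℤ ; +-homo = fromℤ-homo-+ ; *-homo = fromℤ-homo-* ; -‿homo = fromℤ-homo-neg
    ; 0-homo = refl ; 1-homo = refl }

  fromℤ-≟ : ∀ i j → Maybe (fromℤ i ≈ fromℤ j)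
  fromℤ-≟ i j with i ℤ.≟ j
  ... | yes ≡.refl = just refl
  ... | no _       = nothing

  open import Algebra.Solver.Ring ℤ.+-*-rawRing (ACR.fromCommutativeRing R) fromℤ-morphism fromℤ-≟ public

module FiniteFieldProperties {c ℓ : Level} {q : ℕ} (F : FiniteField c ℓ q) where
  open FiniteField F
  open IntegerRingSolver commRing public using (solve; _:=_; _:+_; _:*_; _:-_; :-_; con)
  open import Relation.Binary.Reasoning.Setoid setoid
  open import Algebra.Properties.Ring ring using (-0#≈0#)
  open import Algebra.Properties.Group +-group public using ()
    renaming (x∙y⁻¹≈ε⇒x≈y to x-y≈0⇒x≈y; x≈y⇒x∙y⁻¹≈ε to x≈y⇒x-y≈0; inverseˡ-unique to x+y≈0⇒x≈-y)
  open Inverse finite using (to; from; to-cong; strictlyInverseˡ; strictlyInverseʳ)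

  to-injective : ∀ {x y} → to x ≡ to y → x ≈ y
  to-injective {x} {y} eq = begin
    x           ≈⟨ strictlyInverseʳ x ⟨
    from (to x) ≡⟨ ≡.cong from eq ⟩
    from (to y) ≈⟨ strictlyInverseʳ y ⟩
    y           ∎

  _≟_ : Decidable _≈_
  x ≟ y with to x Fin.≟ to y
  ... | yes eq  = yes (to-injective eq)
  ... | no  neq = no (neq ∘ to-cong)

  _∈｛_,_｝ : Carrier → Carrier → Carrier → Set ℓ
  z ∈｛ x , y ｝ = z ≈ x ⊎ z ≈ y

  1≉0 : ¬ 1# ≈ 0#
  1≉0 = 0≉1 ∘ sym

  +-≈0 : ∀ {x y} → x ≈ 0# → y ≈ 0# → x + y ≈ 0#
  +-≈0 x≈0 y≈0 = trans (+-cong x≈0 y≈0) (+-identityʳ 0#)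

  *ˡ-≈0 : ∀ k {x} → x ≈ 0# → k * x ≈ 0#
  *ˡ-≈0 k x≈0 = trans (*-congˡ x≈0) (zeroʳ k)

  *ʳ-≈0 : ∀ k {x} → x ≈ 0# → x * k ≈ 0#
  *ʳ-≈0 k x≈0 = trans (*-congʳ x≈0) (zeroˡ k)

  -‿≈0 : ∀ {x} → x ≈ 0# → - x ≈ 0#
  -‿≈0 x≈0 = trans (-‿cong x≈0) -0#≈0#

  x≉0⇒x*y≈0⇒y≈0 : ∀ {x y} → ¬ x ≈ 0# → x * y ≈ 0# → y ≈ 0#
  x≉0⇒x*y≈0⇒y≈0 {x} {y} x≉0 xy≈0 = begin
    y                 ≈⟨ *-identityˡ y ⟨
    1# * y            ≈⟨ *-congʳ (trans (*-comm _ _) (inverseʳ x x≉0)) ⟨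
    (x ⁻¹ * x) * y    ≈⟨ *-assoc _ _ _ ⟩
    x ⁻¹ * (x * y)    ≈⟨ *ˡ-≈0 (x ⁻¹) xy≈0 ⟩
    0#                ∎

  x*y≈0⇒x≈0⊎y≈0 : ∀ {x y} → x * y ≈ 0# → x ≈ 0# ⊎ y ≈ 0#
  x*y≈0⇒x≈0⊎y≈0 {x} xy≈0 with x ≟ 0#
  ... | yes x≈0 = inj₁ x≈0
  ... | no  x≉0 = inj₂ (x≉0⇒x*y≈0⇒y≈0 x≉0 xy≈0)

  x*x≈0⇒x≈0 : ∀ {x} → x * x ≈ 0# → x ≈ 0#
  x*x≈0⇒x≈0 xx≈0 with x*y≈0⇒x≈0⊎y≈0 xx≈0
  ... | inj₁ x≈0 = x≈0
  ... | inj₂ x≈0 = x≈0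

  x*y≈1⇒x≉0 : ∀ {x y} → x * y ≈ 1# → ¬ x ≈ 0#
  x*y≈1⇒x≉0 {y = y} xy≈1 x≈0 = 0≉1 (trans (sym (*ʳ-≈0 y x≈0)) xy≈1)

  ⁻¹-unique : ∀ {x y} → x * y ≈ 1# → x ⁻¹ ≈ y
  ⁻¹-unique {x} {y} xy≈1 = begin
    x ⁻¹               ≈⟨ *-identityʳ _ ⟨
    x ⁻¹ * 1#          ≈⟨ *-congˡ xy≈1 ⟨
    x ⁻¹ * (x * y)     ≈⟨ *-assoc _ _ _ ⟨
    (x ⁻¹ * x) * y     ≈⟨ *-congʳ (trans (*-comm _ _) (inverseʳ x (x*y≈1⇒x≉0 xy≈1))) ⟩
    1# * y             ≈⟨ *-identityˡ y ⟩
    y                  ∎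

  x*x≈y*y⇒x≈y⊎x≈-y : ∀ {x y} → x * x ≈ y * y → x ≈ y ⊎ x ≈ - y
  x*x≈y*y⇒x≈y⊎x≈-y {x} {y} xx≈yy
    with x*y≈0⇒x≈0⊎y≈0 (trans (solve 2 (λ x y → (x :- y) :* (x :+ y) := x :* x :- y :* y) refl x y) (x≈y⇒x-y≈0 xx≈yy))
  ... | inj₁ x-y≈0 = inj₁ (x-y≈0⇒x≈y x y x-y≈0)
  ... | inj₂ x+y≈0 = inj₂ (x+y≈0⇒x≈-y x y x+y≈0)

  module _ {l : Carrier} (l-nonSquare : NonSquare l) where

    l≉0 : ¬ l ≈ 0#
    l≉0 l≈0 = l-nonSquare (0# , trans (zeroˡ 0#) (sym l≈0))

    l≉1 : ¬ l ≈ 1#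
    l≉1 l≈1 = l-nonSquare (1# , trans (*-identityˡ 1#) (sym l≈1))

    l*x²≈y²⇒x≈0 : ∀ {x y} → l * (x * x) ≈ y * y → x ≈ 0#
    l*x²≈y²⇒x≈0 {x} {y} lxx≈yy with x ≟ 0#
    ... | yes x≈0 = x≈0
    ... | no  x≉0 = contradiction (y * x ⁻¹ , y/x-squared) l-nonSquare
      where
      y/x-squared : (y * x ⁻¹) * (y * x ⁻¹) ≈ l
      y/x-squared = begin
        (y * x ⁻¹) * (y * x ⁻¹)          ≈⟨ solve 2 (λ y i → (y :* i) :* (y :* i) := (y :* y) :* (i :* i)) refl y (x ⁻¹) ⟩
        (y * y) * (x ⁻¹ * x ⁻¹)          ≈⟨ *-congʳ lxx≈yy ⟨
        (l * (x * x)) * (x ⁻¹ * x ⁻¹)    ≈⟨ solve 3 (λ l x i → (l :* (x :* x)) :* (i :* i) := l :* ((x :* i) :* (x :* i))) refl l x (x ⁻¹) ⟩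
        l * ((x * x ⁻¹) * (x * x ⁻¹))    ≈⟨ *-congˡ (*-cong (inverseʳ x x≉0) (inverseʳ x x≉0)) ⟩
        l * (1# * 1#)                    ≈⟨ *-congˡ (*-identityˡ 1#) ⟩
        l * 1#                           ≈⟨ *-identityʳ l ⟩
        l                                ∎

    l*x²≈y²⇒y≈0 : ∀ {x y} → l * (x * x) ≈ y * y → y ≈ 0#
    l*x²≈y²⇒y≈0 {x} lxx≈yy = x*x≈0⇒x≈0 (trans (sym lxx≈yy) (*ˡ-≈0 l (*ˡ-≈0 x (l*x²≈y²⇒x≈0 lxx≈yy))))

    -- In characteristic 2 squaring is injective, hence surjective on the finite field.
    2≉0 : ¬ 2# ≈ 0#
    2≉0 2≈0 = let i , square-i≡l = injective⇒strictlySurjective square-injective (to l)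
              in l-nonSquare (from i , to-injective square-i≡l)
      where
      squaring-injective : ∀ {x y} → x * x ≈ y * y → x ≈ y
      squaring-injective {x} {y} xx≈yy = x-y≈0⇒x≈y x y (x*x≈0⇒x≈0 (trans
        (solve 2 (λ x y → (x :- y) :* (x :- y) := (x :* x :- y :* y) :+ con (+ 2) :* (y :* y :- x :* y)) refl x y)
        (+-≈0 (x≈y⇒x-y≈0 xx≈yy) (*ʳ-≈0 _ 2≈0))))

      square : Fin q → Fin q
      square i = to (from i * from i)

      square-injective : Injective _≡_ _≡_ square
      square-injective {i} {j} eq = ≡.trans (≡.sym (strictlyInverseˡ i))
        (≡.trans (to-cong (squaring-injective (to-injective eq))) (strictlyInverseˡ j))

module TranslationGraph {c ℓ : Level} {q : ℕ} (F : FiniteField c ℓ q) where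
  open FiniteField F
  open FiniteFieldProperties F
  open import Algebra.Properties.Ring ring using (-0#≈0#; -‿involutive)

  module 𝒢 {l a : Carrier} (l-nonSquare : NonSquare l) (a≉0 : ¬ a ≈ 0#) where
    _⟶_ : Carrier → Carrier → Set ℓ
    _⟶_ = Edge (λ x → x + a) l

    _~_ : Carrier → Carrier → Set (c ⊔ ℓ)
    _~_ = WConnected (λ x → x + a) l

    pred : Carrier → Carrier → Carrier
    pred μ y = μ * (y * y) - a

    edge⇒pred : ∀ {x y} → x ⟶ y → x ≈ pred 1# y ⊎ x ≈ pred l y
    edge⇒pred {x} {y} x⟶y with x*y≈0⇒x≈0⊎y≈0 x⟶y
    ... | inj₁ e = inj₁ (x-y≈0⇒x≈y _ _ (trans
      (solve 3 (λ x y a → x :- (con (+ 1) :* (y :* y) :- a) := :- (y :* y :- (x :+ a))) refl x y a) (-‿≈0 e)))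
    ... | inj₂ e = inj₂ (x-y≈0⇒x≈y _ _ (trans
      (solve 4 (λ l x y a → x :- (l :* (y :* y) :- a) := :- (l :* (y :* y) :- (x :+ a))) refl l x y a) (-‿≈0 e)))

    pred⇒edge : ∀ {x y} → x ≈ pred 1# y ⊎ x ≈ pred l y → x ⟶ y
    pred⇒edge {x} {y} (inj₁ x≈p) = *ʳ-≈0 _ (trans
      (solve 3 (λ x y a → y :* y :- (x :+ a) := :- (x :- (con (+ 1) :* (y :* y) :- a))) refl x y a) (-‿≈0 (x≈y⇒x-y≈0 x≈p)))
    pred⇒edge {x} {y} (inj₂ x≈p) = *ˡ-≈0 _ (trans
      (solve 4 (λ l x y a → l :* (y :* y) :- (x :+ a) := :- (x :- (l :* (y :* y) :- a))) refl l x y a) (-‿≈0 (x≈y⇒x-y≈0 x≈p)))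

    pred-cong : ∀ μ {x y} → x * x ≈ y * y → pred μ x ≈ pred μ y
    pred-cong μ xx≈yy = +-congʳ (*-congˡ xx≈yy)

    pred-cancel : ∀ {μ x y} → ¬ μ ≈ 0# → pred μ x ≈ pred μ y → x * x ≈ y * y
    pred-cancel {μ} {x} {y} μ≉0 px≈py = x-y≈0⇒x≈y _ _ (x≉0⇒x*y≈0⇒y≈0 μ≉0 (trans
      (solve 4 (λ μ x y a → μ :* (x :* x :- y :* y) := (μ :* (x :* x) :- a) :- (μ :* (y :* y) :- a)) refl μ x y a)
      (x≈y⇒x-y≈0 px≈py)))

    pred-1#≈pred-l⇒≈0 : ∀ {x y} → pred 1# x ≈ pred l y → x ≈ 0# × y ≈ 0#
    pred-1#≈pred-l⇒≈0 {x} {y} px≈py = l*x²≈y²⇒y≈0 l-nonSquare lyy≈xx , l*x²≈y²⇒x≈0 l-nonSquare lyy≈xx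
      where
      lyy≈xx : l * (y * y) ≈ x * x
      lyy≈xx = x-y≈0⇒x≈y _ _ (trans
        (solve 4 (λ l x y a → l :* (y :* y) :- x :* x := :- ((con (+ 1) :* (x :* x) :- a) :- (l :* (y :* y) :- a))) refl l x y a)
        (-‿≈0 (x≈y⇒x-y≈0 px≈py)))

    Root : Carrier → Set ℓ
    Root w = ¬ w ≈ 0# × pred 1# w ≈ - w × pred l w ≈ w

    ±-square : ∀ {x w} → x ∈｛ w , - w ｝ → x * x ≈ w * w
    ±-square (inj₁ x≈w)  = *-cong x≈w x≈w
    ±-square {x} {w} (inj₂ x≈-w) = trans (*-cong x≈-w x≈-w) (solve 1 (λ w → (:- w) :* (:- w) := w :* w) refl w)

    ±-forward : ∀ {w x z} → Root w → x ⟶ z → x ∈｛ w , - w ｝ → z ∈｛ w , - w ｝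
    ±-forward (w≉0 , pred-1#-w , pred-l-w) x⟶z x∈± with edge⇒pred x⟶z | x∈±
    ... | inj₁ x≈p | inj₁ x≈w  = ⊥-elim (w≉0 (proj₂ (pred-1#≈pred-l⇒≈0 (trans (sym x≈p) (trans x≈w (sym pred-l-w))))))
    ... | inj₁ x≈p | inj₂ x≈-w = x*x≈y*y⇒x≈y⊎x≈-y (pred-cancel 1≉0 (trans (sym x≈p) (trans x≈-w (sym pred-1#-w))))
    ... | inj₂ x≈p | inj₁ x≈w  = x*x≈y*y⇒x≈y⊎x≈-y (pred-cancel (l≉0 l-nonSquare) (trans (sym x≈p) (trans x≈w (sym pred-l-w))))
    ... | inj₂ x≈p | inj₂ x≈-w = ⊥-elim (w≉0 (proj₁ (pred-1#≈pred-l⇒≈0 (trans pred-1#-w (trans (sym x≈-w) x≈p)))))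

    ±-backward : ∀ {w x z} → Root w → z ⟶ x → x ∈｛ w , - w ｝ → z ∈｛ w , - w ｝
    ±-backward (_ , pred-1#-w , pred-l-w) z⟶x x∈± with edge⇒pred z⟶x
    ... | inj₁ z≈p = inj₂ (trans z≈p (trans (pred-cong 1# (±-square x∈±)) pred-1#-w))
    ... | inj₂ z≈p = inj₁ (trans z≈p (trans (pred-cong l (±-square x∈±)) pred-l-w))

    root⇒component : ∀ {w u} → Root w → u ≈ - w → IsTwoComponent (λ x → x + a) l u w
    root⇒component {w} {u} root@(w≉0 , pred-1#-w , _) u≈-w = u≉w , return (fwd u⟶w) , closed
      where
      u+w≈0 : u + w ≈ 0#
      u+w≈0 = trans (+-congʳ u≈-w) (-‿inverseˡ w)

      u≉w : ¬ u ≈ w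
      u≉w u≈w with x*y≈0⇒x≈0⊎y≈0 (trans (solve 2 (λ u w → con (+ 2) :* w := (u :+ w) :- (u :- w)) refl u w)
                                         (+-≈0 u+w≈0 (-‿≈0 (x≈y⇒x-y≈0 u≈w))))
      ... | inj₁ 2≈0 = 2≉0 l-nonSquare 2≈0
      ... | inj₂ w≈0 = w≉0 w≈0

      u⟶w : u ⟶ w
      u⟶w = pred⇒edge (inj₁ (trans u≈-w (sym pred-1#-w)))

      closed : ∀ z → u ~ z → z ∈｛ u , w ｝
      closed z u~z with EqClosure-preserves _∈｛ w , - w ｝ (±-forward root) (±-backward root) u~z (inj₂ u≈-w)
      ... | inj₁ z≈w  = inj₂ z≈w
      ... | inj₂ z≈-w = inj₁ (trans z≈-w (sym u≈-w))

    preds-closed : ∀ {x y s} → (∀ z → x ~ z → z ∈｛ x , y ｝) → x ~ s → pred 1# s ∈｛ x , y ｝ × pred l s ∈｛ x , y ｝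
    preds-closed closed x~s = closed _ (x~s ◅◅ return (bwd (pred⇒edge (inj₁ refl))))
                            , closed _ (x~s ◅◅ return (bwd (pred⇒edge (inj₂ refl))))

    preds-split : ∀ {x y s} → ¬ s ≈ 0# → pred 1# s ∈｛ x , y ｝ → pred l s ∈｛ x , y ｝ →
                  (pred 1# s ≈ x × pred l s ≈ y) ⊎ (pred 1# s ≈ y × pred l s ≈ x)
    preds-split s≉0 (inj₁ p≈x) (inj₂ q≈y) = inj₁ (p≈x , q≈y)
    preds-split s≉0 (inj₂ p≈y) (inj₁ q≈x) = inj₂ (p≈y , q≈x)
    preds-split s≉0 (inj₁ p≈x) (inj₁ q≈x) = ⊥-elim (s≉0 (proj₁ (pred-1#≈pred-l⇒≈0 (trans p≈x (sym q≈x)))))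
    preds-split s≉0 (inj₂ p≈y) (inj₂ q≈y) = ⊥-elim (s≉0 (proj₁ (pred-1#≈pred-l⇒≈0 (trans p≈y (sym q≈y)))))

    pred-zero : ∀ μ {x} → x ≈ 0# → pred μ x ≈ - a
    pred-zero μ {x} x≈0 = trans (+-congʳ (*ˡ-≈0 μ (*ˡ-≈0 x x≈0))) (+-identityˡ (- a))

    pred-fixed⇒≈0 : ∀ {μ y} → ¬ μ ≈ 0# → pred μ y ≈ y → y ≈ - a → y ≈ 0#
    pred-fixed⇒≈0 {μ} {y} μ≉0 py≈y y≈-a = x*x≈0⇒x≈0 (x≉0⇒x*y≈0⇒y≈0 μ≉0 (trans
      (solve 3 (λ μ y a → μ :* (y :* y) := ((μ :* (y :* y) :- a) :- y) :+ (y :+ a)) refl μ y a)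
      (+-≈0 (x≈y⇒x-y≈0 py≈y) (trans (+-congʳ y≈-a) (-‿inverseˡ a)))))

    -- If x = 0 then pred 1# x = −a ≉ x forces y = −a, and an in-neighbour of y equal to y would give
    -- μy² = y + a = 0.
    closedPair-nonzero : ∀ {x y} → ¬ x ≈ y →
      pred 1# x ∈｛ x , y ｝ → pred 1# y ∈｛ x , y ｝ → pred l y ∈｛ x , y ｝ → ¬ x ≈ 0#
    closedPair-nonzero {x} {y} x≉y p1x p1y ply x≈0 with p1x
    ... | inj₁ p≈x = a≉0 (trans (sym (-‿involutive a)) (-‿≈0 (trans (sym (pred-zero 1# x≈0)) (trans p≈x x≈0))))
    ... | inj₂ p≈y with trans (sym p≈y) (pred-zero 1# x≈0) | preds-split (λ y≈0 → x≉y (trans x≈0 (sym y≈0))) p1y ply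
    ...   | y≈-a | inj₁ (_ , ply≈y) = x≉y (trans x≈0 (sym (pred-fixed⇒≈0 (l≉0 l-nonSquare) ply≈y y≈-a)))
    ...   | y≈-a | inj₂ (p1y≈y , _) = x≉y (trans x≈0 (sym (pred-fixed⇒≈0 1≉0 p1y≈y y≈-a)))

    -- Subtracting the equations gives μ(s + t) = 1 = −ν(s + t), so μ + ν = 0 and then
    -- λ(s − t)² = μν(s − t)² = 1.
    fix-swap-impossible : ∀ {μ ν s t} → μ * ν ≈ l → ¬ s ≈ t →
      pred μ s ≈ s → pred μ t ≈ t → pred ν s ≈ t → pred ν t ≈ s → ⊥
    fix-swap-impossible {μ} {ν} {s} {t} μν≈l s≉t μs≈s μt≈t νs≈t νt≈s =
      s≉t (x-y≈0⇒x≈y s t (l*x²≈y²⇒x≈0 l-nonSquare l[s-t]²≈1²))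
      where
      s-t≉0 : ¬ s - t ≈ 0#
      s-t≉0 = s≉t ∘ x-y≈0⇒x≈y s t

      μ[s+t]-1≈0 : μ * (s + t) - 1# ≈ 0#
      μ[s+t]-1≈0 = x≉0⇒x*y≈0⇒y≈0 s-t≉0 (trans
        (solve 4 (λ μ s t a → (s :- t) :* (μ :* (s :+ t) :- con (+ 1))
                           := ((μ :* (s :* s) :- a) :- s) :- ((μ :* (t :* t) :- a) :- t)) refl μ s t a)
        (+-≈0 (x≈y⇒x-y≈0 μs≈s) (-‿≈0 (x≈y⇒x-y≈0 μt≈t))))

      ν[s+t]+1≈0 : ν * (s + t) + 1# ≈ 0#
      ν[s+t]+1≈0 = x≉0⇒x*y≈0⇒y≈0 s-t≉0 (trans
        (solve 4 (λ ν s t a → (s :- t) :* (ν :* (s :+ t) :+ con (+ 1))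
                           := ((ν :* (s :* s) :- a) :- t) :- ((ν :* (t :* t) :- a) :- s)) refl ν s t a)
        (+-≈0 (x≈y⇒x-y≈0 νs≈t) (-‿≈0 (x≈y⇒x-y≈0 νt≈s))))

      μ+ν≈0 : μ + ν ≈ 0#
      μ+ν≈0 = trans
        (solve 4 (λ μ ν s t → μ :+ ν := (μ :+ ν) :* (:- (μ :* (s :+ t) :- con (+ 1)))
                                       :+ μ :* (μ :* (s :+ t) :- con (+ 1)) :+ μ :* (ν :* (s :+ t) :+ con (+ 1))) refl μ ν s t)
        (+-≈0 (+-≈0 (*ˡ-≈0 _ (-‿≈0 μ[s+t]-1≈0)) (*ˡ-≈0 μ μ[s+t]-1≈0)) (*ˡ-≈0 μ ν[s+t]+1≈0))

      μ²[s-t]²+1≈0 : (μ * μ) * ((s - t) * (s - t)) + 1# ≈ 0#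
      μ²[s-t]²+1≈0 = trans
        (solve 5 (λ μ ν s t a → (μ :* μ) :* ((s :- t) :* (s :- t)) :+ con (+ 1)
                             := con (+ 2) :* μ :* (((μ :* (s :* s) :- a) :- s) :- ((ν :* (s :* s) :- a) :- t))
                                :+ con (+ 2) :* μ :* (s :* s) :* (μ :+ ν)
                                :- (μ :* (s :+ t) :- con (+ 1)) :* (con (+ 4) :* μ :* s :- (μ :* (s :+ t) :- con (+ 1)))) refl μ ν s t a)
        (+-≈0 (+-≈0 (*ˡ-≈0 _ (+-≈0 (x≈y⇒x-y≈0 μs≈s) (-‿≈0 (x≈y⇒x-y≈0 νs≈t)))) (*ˡ-≈0 _ μ+ν≈0))
              (-‿≈0 (*ʳ-≈0 _ μ[s+t]-1≈0)))

      l[s-t]²≈1² : l * ((s - t) * (s - t)) ≈ 1# * 1#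
      l[s-t]²≈1² = x-y≈0⇒x≈y _ _ (trans
        (solve 5 (λ μ ν s t l → l :* ((s :- t) :* (s :- t)) :- con (+ 1) :* con (+ 1)
                             := :- ((μ :* ν :- l) :* ((s :- t) :* (s :- t))) :+ μ :* (μ :+ ν) :* ((s :- t) :* (s :- t))
                                :- ((μ :* μ) :* ((s :- t) :* (s :- t)) :+ con (+ 1))) refl μ ν s t l)
        (+-≈0 (+-≈0 (-‿≈0 (*ʳ-≈0 _ (x≈y⇒x-y≈0 μν≈l))) (*ʳ-≈0 _ (*ˡ-≈0 μ μ+ν≈0))) (-‿≈0 μ²[s-t]²+1≈0)))

    fixed-pair⇒root : ∀ {w t} → ¬ t ≈ w → pred 1# w ≈ t → pred 1# t ≈ t → pred l w ≈ w → Root w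
    fixed-pair⇒root {w} {t} t≉w p1w≈t p1t≈t plw≈w
      with x*x≈y*y⇒x≈y⊎x≈-y (pred-cancel 1≉0 (trans p1t≈t (sym p1w≈t)))
    ... | inj₁ t≈w  = ⊥-elim (t≉w t≈w)
    ... | inj₂ t≈-w = (λ w≈0 → t≉w (trans t≈-w (trans (-‿cong w≈0) (trans -0#≈0# (sym w≈0)))))
                    , trans p1w≈t t≈-w , plw≈w

    closedPair⇒root : ∀ {x y} → ¬ x ≈ y →
      pred 1# x ∈｛ x , y ｝ → pred l x ∈｛ x , y ｝ → pred 1# y ∈｛ x , y ｝ → pred l y ∈｛ x , y ｝ → ∃ Root
    closedPair⇒root x≉y p1x plx p1y ply
      with preds-split (closedPair-nonzero x≉y p1x p1y ply) p1x plx
         | preds-split (closedPair-nonzero (x≉y ∘ sym) (swap p1y) (swap p1x) (swap plx)) p1y ply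
    ... | inj₁ (p1x≈x , _)     | inj₁ (p1y≈x , ply≈y) = _ , fixed-pair⇒root x≉y p1y≈x p1x≈x ply≈y
    ... | inj₁ (p1x≈x , plx≈y) | inj₂ (p1y≈y , ply≈x) = ⊥-elim (fix-swap-impossible (*-identityˡ l) x≉y p1x≈x p1y≈y plx≈y ply≈x)
    ... | inj₂ (p1x≈y , plx≈x) | inj₁ (p1y≈x , ply≈y) = ⊥-elim (fix-swap-impossible (*-identityʳ l) x≉y plx≈x ply≈y p1x≈y p1y≈x)
    ... | inj₂ (p1x≈y , plx≈x) | inj₂ (p1y≈y , _)     = _ , fixed-pair⇒root (x≉y ∘ sym) p1x≈y p1y≈y plx≈x

    component⇒root : ∀ {x y} → IsTwoComponent (λ z → z + a) l x y → ∃ Root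
    component⇒root (x≉y , x~y , closed) =
      let p1x , plx = preds-closed closed ε
          p1y , ply = preds-closed closed x~y
      in closedPair⇒root x≉y p1x plx p1y ply

    target : Carrier
    target = (2# * (l + 1#)) / ((l - 1#) * (l - 1#))

    [l-1]⁻¹ : Carrier
    [l-1]⁻¹ = (l - 1#) ⁻¹

    [l-1]*[l-1]⁻¹≈1 : (l - 1#) * [l-1]⁻¹ ≈ 1#
    [l-1]*[l-1]⁻¹≈1 = inverseʳ _ (l≉1 l-nonSquare ∘ x-y≈0⇒x≈y l 1#)

    target≈2[l+1][l-1]⁻² : target ≈ (2# * (l + 1#)) * ([l-1]⁻¹ * [l-1]⁻¹)
    target≈2[l+1][l-1]⁻² = *-congˡ (⁻¹-unique (trans
      (solve 2 (λ l i → ((l :- con (+ 1)) :* (l :- con (+ 1))) :* (i :* i) := ((l :- con (+ 1)) :* i) :* ((l :- con (+ 1)) :* i)) refl l [l-1]⁻¹)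
      (trans (*-cong [l-1]*[l-1]⁻¹≈1 [l-1]*[l-1]⁻¹≈1) (*-identityˡ 1#))))

    2/[1-l]≈-2/[l-1] : 2# / (1# - l) ≈ - (2# / (l - 1#))
    2/[1-l]≈-2/[l-1] = trans (*-congˡ (⁻¹-unique (trans
      (solve 2 (λ l i → (con (+ 1) :- l) :* (:- i) := (l :- con (+ 1)) :* i) refl l [l-1]⁻¹) [l-1]*[l-1]⁻¹≈1)))
      (solve 1 (λ i → con (+ 2) :* (:- i) := :- (con (+ 2) :* i)) refl [l-1]⁻¹)

    root-value : ∀ {w} → Root w → w ≈ 2# / (l - 1#)
    root-value {w} (w≉0 , p1w≈-w , plw≈w) = x-y≈0⇒x≈y _ _ (trans
      (solve 3 (λ l w i → w :- con (+ 2) :* i := (:- w) :* ((l :- con (+ 1)) :* i :- con (+ 1)) :+ i :* ((l :- con (+ 1)) :* w :- con (+ 2))) refl l w [l-1]⁻¹)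
      (+-≈0 (*ˡ-≈0 _ (x≈y⇒x-y≈0 [l-1]*[l-1]⁻¹≈1)) (*ˡ-≈0 _ [l-1]w-2≈0)))
      where
      [l-1]w-2≈0 : (l - 1#) * w - 2# ≈ 0#
      [l-1]w-2≈0 = x≉0⇒x*y≈0⇒y≈0 w≉0 (trans
        (solve 3 (λ l w a → w :* ((l :- con (+ 1)) :* w :- con (+ 2)) := ((l :* (w :* w) :- a) :- w) :- ((con (+ 1) :* (w :* w) :- a) :- (:- w))) refl l w a)
        (+-≈0 (x≈y⇒x-y≈0 plw≈w) (-‿≈0 (x≈y⇒x-y≈0 p1w≈-w))))

    root⇒target : ∀ {w} → Root w → ¬ l ≈ - 1# × a ≈ target
    root⇒target {w} root@(_ , p1w≈-w , plw≈w) = l≉-1 , trans (x-y≈0⇒x≈y _ _ a-2[l+1][l-1]⁻²≈0) (sym target≈2[l+1][l-1]⁻²)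
      where
      a-2[l+1][l-1]⁻²≈0 : a - (2# * (l + 1#)) * ([l-1]⁻¹ * [l-1]⁻¹) ≈ 0#
      a-2[l+1][l-1]⁻²≈0 = trans
        (solve 4 (λ l w i a → a :- (con (+ 2) :* (l :+ con (+ 1))) :* (i :* i)
                           := :- ((con (+ 1) :* (w :* w) :- a) :- (:- w))
                              :+ (w :- con (+ 2) :* i) :* (w :+ con (+ 2) :* i :+ con (+ 1))
                              :- con (+ 2) :* i :* ((l :- con (+ 1)) :* i :- con (+ 1))) refl l w [l-1]⁻¹ a)
        (+-≈0 (+-≈0 (-‿≈0 (x≈y⇒x-y≈0 p1w≈-w)) (*ʳ-≈0 _ (x≈y⇒x-y≈0 (root-value root))))
              (-‿≈0 (*ˡ-≈0 _ (x≈y⇒x-y≈0 [l-1]*[l-1]⁻¹≈1))))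
      l≉-1 : ¬ l ≈ - 1#
      l≉-1 l≈-1 with x*y≈0⇒x≈0⊎y≈0 (trans
        (solve 3 (λ l w a → con (+ 2) :* a := :- ((con (+ 1) :* (w :* w) :- a) :- (:- w)) :- ((l :* (w :* w) :- a) :- w)
                                             :+ (l :+ con (+ 1)) :* (w :* w)) refl l w a)
        (+-≈0 (+-≈0 (-‿≈0 (x≈y⇒x-y≈0 p1w≈-w)) (-‿≈0 (x≈y⇒x-y≈0 plw≈w)))
              (*ʳ-≈0 _ (trans (+-congʳ l≈-1) (-‿inverseˡ 1#)))))
      ... | inj₁ 2≈0 = 2≉0 l-nonSquare 2≈0
      ... | inj₂ a≈0 = a≉0 a≈0

    target⇒root : a ≈ target → Root (2# / (l - 1#))
    target⇒root a≈target = 2[l-1]⁻¹≉0 , x-y≈0⇒x≈y _ _ pred-1#-w+w≈0 , x-y≈0⇒x≈y _ _ pred-l-w-w≈0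
      where
      a-2[l+1][l-1]⁻²≈0 : a - (2# * (l + 1#)) * ([l-1]⁻¹ * [l-1]⁻¹) ≈ 0#
      a-2[l+1][l-1]⁻²≈0 = x≈y⇒x-y≈0 (trans a≈target target≈2[l+1][l-1]⁻²)
      2[l-1]⁻¹≉0 : ¬ 2# * [l-1]⁻¹ ≈ 0#
      2[l-1]⁻¹≉0 2[l-1]⁻¹≈0 with x*y≈0⇒x≈0⊎y≈0 2[l-1]⁻¹≈0
      ... | inj₁ 2≈0 = 2≉0 l-nonSquare 2≈0
      ... | inj₂ i≈0 = x*y≈1⇒x≉0 (trans (*-comm _ _) [l-1]*[l-1]⁻¹≈1) i≈0
      pred-1#-w+w≈0 : (1# * ((2# * [l-1]⁻¹) * (2# * [l-1]⁻¹)) - a) - - (2# * [l-1]⁻¹) ≈ 0#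
      pred-1#-w+w≈0 = trans
        (solve 3 (λ l i a → (con (+ 1) :* ((con (+ 2) :* i) :* (con (+ 2) :* i)) :- a) :- (:- (con (+ 2) :* i))
                         := :- (a :- (con (+ 2) :* (l :+ con (+ 1))) :* (i :* i)) :- con (+ 2) :* i :* ((l :- con (+ 1)) :* i :- con (+ 1))) refl l [l-1]⁻¹ a)
        (+-≈0 (-‿≈0 a-2[l+1][l-1]⁻²≈0) (-‿≈0 (*ˡ-≈0 _ (x≈y⇒x-y≈0 [l-1]*[l-1]⁻¹≈1))))
      pred-l-w-w≈0 : (l * ((2# * [l-1]⁻¹) * (2# * [l-1]⁻¹)) - a) - 2# * [l-1]⁻¹ ≈ 0#
      pred-l-w-w≈0 = trans
        (solve 3 (λ l i a → (l :* ((con (+ 2) :* i) :* (con (+ 2) :* i)) :- a) :- con (+ 2) :* i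
                         := :- (a :- (con (+ 2) :* (l :+ con (+ 1))) :* (i :* i)) :+ con (+ 2) :* i :* ((l :- con (+ 1)) :* i :- con (+ 1))) refl l [l-1]⁻¹ a)
        (+-≈0 (-‿≈0 a-2[l+1][l-1]⁻²≈0) (*ˡ-≈0 _ (x≈y⇒x-y≈0 [l-1]*[l-1]⁻¹≈1)))

proposition4p5 : ∀ {c ℓ : Level} (q p k : ℕ) → Prime p → p ≢ 2 → q ≡ p ^ k →
    (F : FiniteField c ℓ q) → let open FiniteField F in
    ∀ (l a : Carrier) → NonSquare l → ¬ (a ≈ 0#) →
      (HasTwoComponent (λ x → x + a) l
         ⇔ (¬ (l ≈ - 1#) × a ≈ (2# * (l + 1#)) / ((l - 1#) * (l - 1#))))
      × (¬ (l ≈ - 1#) → a ≈ (2# * (l + 1#)) / ((l - 1#) * (l - 1#)) →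
           IsTwoComponent (λ x → x + a) l (2# / (1# - l)) (2# / (l - 1#)))
proposition4p5 _ _ _ _ _ _ F l a l-nonSquare a≉0 =
  mk⇔ (λ (_ , _ , component) → root⇒target (proj₂ (component⇒root component)))
      (λ (_ , a≈target) → -, -, pair-component a≈target)
  , λ _ → pair-component
  where
  open FiniteField F
  open TranslationGraph F
  open 𝒢 l-nonSquare a≉0

  pair-component : a ≈ target → IsTwoComponent (λ x → x + a) l (2# / (1# - l)) (2# / (l - 1#))
  pair-component a≈target = root⇒component (target⇒root a≈target) 2/[1-l]≈-2/[l-1]
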